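{- For a nonnegative integer $d$, let $$p_k(m)=\prod_{i=0}^{k-1}(m+i+1-r),\qquad g_k(u,d)=\binom{d}{k}\prod_{i=0}^{k-1}(r+i)\prod_{j=k+1}^{d}(d-j+r)(u+j+r),$$ and $\mathbf{N}^u_d(m)=\sum_{k=0}^{d}g_k(u,d)p_k(m)$. Then $$(u-m)(u+d+r)\,\mathbf{N}^{u-1}_d(m)=\sum_{k=0}^{d}\sum_{i=0}^{2}g_k(u,d)\,\gamma^{2,i}_k(u,d)\,p_{k+i}(m),$$ where $\gamma^{2,0}_k(u,d)=(u+k+1-r)(u+k+r)$, $\gamma^{2,1}_k(u,d)=-(u+k+r)$, and $\gamma^{2,2}_k(u,d)=0$.
   Context: $r,u,m$ are indeterminates (the identity is a polynomial identity in $r,u,m$); $d$ is a nonnegative integer. -}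

module Defs where

open import Level using (Level)
open import Data.Nat using (ℕ; zero; suc; _∸_) renaming (_+_ to _+ℕ_)
open import Data.Nat.Combinatorics using (_C_)
open import Algebra.Bundles using (CommutativeRing)

-- All definitions are relative to an arbitrary commutative ring R;
-- the indeterminates r, u, m are arbitrary elements of R.
module WithRing {c ℓ : Level} (R : CommutativeRing c ℓ) where
  open CommutativeRing R

  ι : ℕ → Carrier
  ι zero    = 0#
  ι (suc n) = 1# + ι n

  ∏ : (ℕ → Carrier) → ℕ → ℕ → Carrier
  ∏ f a zero    = 1#
  ∏ f a (suc n) = f a * ∏ f (suc a) n

  ∑ : (ℕ → Carrier) → ℕ → ℕ → Carrier
  ∑ f a zero    = 0#
  ∑ f a (suc n) = f a + ∑ f (suc a) n

  p : (r : Carrier) → ℕ → Carrier → Carrier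
  p r k m = ∏ (λ i → m + ι i + 1# - r) 0 k

  g : (r : Carrier) → ℕ → Carrier → ℕ → Carrier
  g r k u d =
    ι (d C k) * ∏ (λ i → r + ι i) 0 k
              * ∏ (λ j → (ι (d ∸ j) + r) * (u + ι j + r)) (suc k) (d ∸ k)

  N : (r : Carrier) → Carrier → ℕ → Carrier → Carrier
  N r u d m = ∑ (λ k → g r k u d * p r k m) 0 (suc d)

  γ : (r : Carrier) → ℕ → ℕ → Carrier → ℕ → Carrier
  γ r 0 k u d = (u + ι k + 1# - r) * (u + ι k + r)
  γ r 1 k u d = - (u + ι k + r)
  γ r _ k u d = 0#

{-# OPTIONS --safe #-}

-- The identity holds summand by summand.  Passing from u - 1 to u only changes the
-- product over j in g_k, and that product telescopes:
--   (u+d+r) ∏_{j=k+1}^{d} (d-j+r)(u-1+j+r) = (u+k+r) ∏_{j=k+1}^{d} (d-j+r)(u+j+r).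
-- What is left is (u-m)(u+k+r) = γ⁰_k + γ¹_k (m+k+1-r), where the last factor
-- turns p_k into p_{k+1}.
module Submission where

open import Level using (Level)
open import Data.Maybe using (Maybe; just; nothing)
open import Data.Nat as ℕ using (ℕ; zero; suc; _∸_; _<_; _≤_; z≤n; s≤s) renaming (_+_ to _+ℕ_)
import Data.Nat.Properties as ℕ
open import Data.Nat.Combinatorics using (_C_)
open import Data.Integer as ℤ using (ℤ; +_; -[1+_]; _⊖_; _◃_)
import Data.Integer.Properties as ℤ
open import Data.Sign as Sign using (Sign)
open import Relation.Nullary using (yes; no)
import Relation.Binary.PropositionalEquality as ≡
open import Algebra.Bundles using (CommutativeRing)
import Algebra.Properties.Ring as RingProperties
import Algebra.Properties.CommutativeSemigroup as CommutativeSemigroupProperties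
import Algebra.Properties.Semiring.Mult as SemiringMultProperties
import Algebra.Solver.Ring.AlmostCommutativeRing as ACR
import Relation.Binary.Reasoning.Setoid as SetoidReasoning
open import Defs

module IntegerCoefficientSolver {c ℓ : Level} (R : CommutativeRing c ℓ) where
  open CommutativeRing R
  open RingProperties ring
  open SemiringMultProperties semiring
  open SetoidReasoning setoid

  fromℤ : ℤ → Carrier
  fromℤ (+ n)      = n × 1#
  fromℤ (-[1+ n ]) = - (suc n × 1#)

  ⊖-homo : ∀ m n → fromℤ (m ⊖ n) ≈ m × 1# - n × 1#
  ⊖-homo m zero rewrite ℤ.⊖-≥ {m} {0} z≤n =
    sym (trans (+-congˡ -0#≈0#) (+-identityʳ (m × 1#)))
  ⊖-homo zero (suc n) rewrite ℤ.⊖-< {0} {suc n} (s≤s z≤n) =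
    sym (+-identityˡ _)
  ⊖-homo (suc m) (suc n) rewrite ℤ.[1+m]⊖[1+n]≡m⊖n m n = begin
    fromℤ (m ⊖ n)                       ≈⟨ ⊖-homo m n ⟩
    m × 1# - n × 1#                 ≈⟨ sym (+-identityˡ _) ⟩
    0# + (m × 1# - n × 1#)          ≈⟨ +-congʳ (sym (-‿inverseʳ 1#)) ⟩
    (1# - 1#) + (m × 1# - n × 1#)   ≈⟨ CommutativeSemigroupProperties.interchange
                                         +-commutativeSemigroup 1# (- 1#) (m × 1#) (- (n × 1#)) ⟩
    (1# + m × 1#) + (- 1# - n × 1#) ≈⟨ +-congˡ (-‿+-comm 1# (n × 1#)) ⟩
    (1# + m × 1#) - (1# + n × 1#)   ∎

  signed : Sign → Carrier → Carrier
  signed Sign.+ x = x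
  signed Sign.- x = - x

  ◃-homo : ∀ s n → fromℤ (s ◃ n) ≈ signed s (n × 1#)
  ◃-homo Sign.+ zero    = refl
  ◃-homo Sign.- zero    = sym -0#≈0#
  ◃-homo Sign.+ (suc n) = refl
  ◃-homo Sign.- (suc n) = refl

  +-homo : ∀ i j → fromℤ (i ℤ.+ j) ≈ fromℤ i + fromℤ j
  +-homo (+ m)    (+ n)    = ×-homo-+ 1# m n
  +-homo (+ m)    -[1+ n ] = ⊖-homo m (suc n)
  +-homo -[1+ m ] (+ n)    = trans (⊖-homo n (suc m)) (+-comm _ _)
  +-homo -[1+ m ] -[1+ n ] = begin
    - (suc (suc (m +ℕ n)) × 1#)      ≈⟨ -‿cong (×-congˡ (≡.cong suc (≡.sym (ℕ.+-suc m n)))) ⟩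
    - (suc m +ℕ suc n) × 1#          ≈⟨ -‿cong (×-homo-+ 1# (suc m) (suc n)) ⟩
    - (suc m × 1# + suc n × 1#)      ≈⟨ sym (-‿+-comm _ _) ⟩
    - (suc m × 1#) + - (suc n × 1#)  ∎

  *-homo : ∀ i j → fromℤ (i ℤ.* j) ≈ fromℤ i * fromℤ j
  *-homo (+ m) (+ n) = trans (◃-homo Sign.+ (m ℕ.* n)) (×1-homo-* m n)
  *-homo (+ m) -[1+ n ] = trans (◃-homo Sign.- (m ℕ.* suc n))
    (trans (-‿cong (×1-homo-* m (suc n))) (-‿distribʳ-* _ _))
  *-homo -[1+ m ] (+ n) = trans (◃-homo Sign.- (suc m ℕ.* n))
    (trans (-‿cong (×1-homo-* (suc m) n)) (-‿distribˡ-* _ _))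
  *-homo -[1+ m ] -[1+ n ] = begin
    fromℤ (Sign.+ ◃ (suc m ℕ.* suc n))        ≈⟨ ◃-homo Sign.+ (suc m ℕ.* suc n) ⟩
    (suc m ℕ.* suc n) × 1#                ≈⟨ ×1-homo-* (suc m) (suc n) ⟩
    suc m × 1# * suc n × 1#               ≈⟨ sym (-‿involutive _) ⟩
    - - (suc m × 1# * suc n × 1#)         ≈⟨ -‿cong (-‿distribˡ-* _ _) ⟩
    - (- (suc m × 1#) * suc n × 1#)       ≈⟨ -‿distribʳ-* _ _ ⟩
    - (suc m × 1#) * - (suc n × 1#)       ∎

  -‿homo : ∀ i → fromℤ (ℤ.- i) ≈ - fromℤ i
  -‿homo (+ zero)  = sym -0#≈0#
  -‿homo (+ suc n) = refl
  -‿homo -[1+ n ]  = sym (-‿involutive _)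

  ℤ⟶R : ACR._-Raw-AlmostCommutative⟶_ ℤ.+-*-rawRing (ACR.fromCommutativeRing R)
  ℤ⟶R = record
    { ⟦_⟧    = fromℤ
    ; +-homo = +-homo
    ; *-homo = *-homo
    ; -‿homo = -‿homo
    ; 0-homo = refl
    ; 1-homo = +-identityʳ 1#
    }

  fromℤ-≟ : ∀ i j → Maybe (fromℤ i ≈ fromℤ j)
  fromℤ-≟ i j with i ℤ.≟ j
  ... | yes ≡.refl = just refl
  ... | no _       = nothing

  open import Algebra.Solver.Ring ℤ.+-*-rawRing (ACR.fromCommutativeRing R) ℤ⟶R fromℤ-≟ public

module _ {c ℓ : Level} (R : CommutativeRing c ℓ) where
  open CommutativeRing R
  open WithRing R
  open CommutativeSemigroupProperties *-commutativeSemigroup using (x∙yz≈y∙xz; x∙yz≈yx∙z)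
  open IntegerCoefficientSolver R using (solve; con; _:+_; _:-_; _:*_; :-_; _:=_)
  open SetoidReasoning setoid

  ∏-snoc : ∀ f a n → ∏ f a (n +ℕ 1) ≈ ∏ f a n * f (a +ℕ n)
  ∏-snoc f a zero =
    trans (*-comm _ _) (*-congˡ (reflexive (≡.cong f (≡.sym (ℕ.+-identityʳ a)))))
  ∏-snoc f a (suc n) = begin
    f a * ∏ f (suc a) (n +ℕ 1)             ≈⟨ *-congˡ (∏-snoc f (suc a) n) ⟩
    f a * (∏ f (suc a) n * f (suc a +ℕ n)) ≈⟨ sym (*-assoc _ _ _) ⟩
    f a * ∏ f (suc a) n * f (suc a +ℕ n)   ≈⟨ *-congˡ (reflexive (≡.cong f (≡.sym (ℕ.+-suc a n)))) ⟩
    f a * ∏ f (suc a) n * f (a +ℕ suc n)   ∎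

  ∏-telescope : ∀ (w f h : ℕ → Carrier) → (∀ j → w (suc j) * f (suc j) ≈ w j * h (suc j)) →
                ∀ a n → w (a +ℕ n) * ∏ f (suc a) n ≈ w a * ∏ h (suc a) n
  ∏-telescope w f h step a zero = *-congʳ (reflexive (≡.cong w (ℕ.+-identityʳ a)))
  ∏-telescope w f h step a (suc n) = begin
    w (a +ℕ suc n) * (f (suc a) * ∏ f (2 +ℕ a) n) ≈⟨ *-congʳ (reflexive (≡.cong w (ℕ.+-suc a n))) ⟩
    w (suc a +ℕ n) * (f (suc a) * ∏ f (2 +ℕ a) n) ≈⟨ x∙yz≈y∙xz _ _ _ ⟩
    f (suc a) * (w (suc a +ℕ n) * ∏ f (2 +ℕ a) n) ≈⟨ *-congˡ (∏-telescope w f h step (suc a) n) ⟩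
    f (suc a) * (w (suc a) * ∏ h (2 +ℕ a) n)      ≈⟨ x∙yz≈yx∙z _ _ _ ⟩
    w (suc a) * f (suc a) * ∏ h (2 +ℕ a) n        ≈⟨ *-congʳ (step a) ⟩
    w a * h (suc a) * ∏ h (2 +ℕ a) n              ≈⟨ *-assoc _ _ _ ⟩
    w a * (h (suc a) * ∏ h (2 +ℕ a) n)            ∎

  ∑-cong-< : ∀ f h a n → (∀ i → i < a +ℕ n → f i ≈ h i) → ∑ f a n ≈ ∑ h a n
  ∑-cong-< f h a zero    f≈h = refl
  ∑-cong-< f h a (suc n) f≈h = +-cong (f≈h a (ℕ.m<m+n a (s≤s z≤n)))
    (∑-cong-< f h (suc a) n (λ i i<a+1+n → f≈h i (≡.subst (i <_) (≡.sym (ℕ.+-suc a n)) i<a+1+n)))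

  *-distribˡ-∑ : ∀ x f a n → x * ∑ f a n ≈ ∑ (λ k → x * f k) a n
  *-distribˡ-∑ x f a zero    = zeroʳ x
  *-distribˡ-∑ x f a (suc n) = trans (distribˡ x _ _) (+-congˡ (*-distribˡ-∑ x f (suc a) n))

  p-+1 : ∀ r k m → p r (k +ℕ 1) m ≈ p r k m * (m + ι k + 1# - r)
  p-+1 r k m = ∏-snoc (λ i → m + ι i + 1# - r) 0 k

  g-pred-u : ∀ r u d k → k ≤ d →
             (u + ι d + r) * g r k (u - 1#) d ≈ (u + ι k + r) * g r k u d
  g-pred-u r u d k k≤d = begin
    (u + ι d + r) * (Cr * Π (u - 1#))   ≈⟨ x∙yz≈y∙xz _ _ _ ⟩
    Cr * ((u + ι d + r) * Π (u - 1#))   ≈⟨ *-congˡ (*-congʳ (reflexive (≡.cong w (≡.sym (ℕ.m+[n∸m]≡n k≤d))))) ⟩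
    Cr * (w (k +ℕ (d ∸ k)) * Π (u - 1#)) ≈⟨ *-congˡ (∏-telescope w (F (u - 1#)) (F u) shift k (d ∸ k)) ⟩
    Cr * ((u + ι k + r) * Π u)          ≈⟨ x∙yz≈y∙xz _ _ _ ⟩
    (u + ι k + r) * (Cr * Π u)          ∎
    where
    Cr : Carrier
    Cr = ι (d C k) * ∏ (λ i → r + ι i) 0 k
    F : Carrier → ℕ → Carrier
    F v j = (ι (d ∸ j) + r) * (v + ι j + r)
    Π : Carrier → Carrier
    Π v = ∏ (F v) (suc k) (d ∸ k)
    w : ℕ → Carrier
    w j = u + ι j + r
    -- ι (suc j) unfolds to 1# + ι j, written o :+ J below.
    shift : ∀ j → w (suc j) * F (u - 1#) (suc j) ≈ w j * F u (suc j)
    shift j = solve 5 (λ U J R X o → (U :+ (o :+ J) :+ R) :* ((X :+ R) :* (U :- o :+ (o :+ J) :+ R))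
                                   := (U :+ J :+ R) :* ((X :+ R) :* (U :+ (o :+ J) :+ R)))
                refl u (ι j) r (ι (d ∸ suc j)) 1#

  γ-split : ∀ r u m k d → (u - m) * (u + ι k + r) ≈ γ r 0 k u d + γ r 1 k u d * (m + ι k + 1# - r)
  γ-split r u m k d = solve 5 (λ U M K R o → (U :- M) :* (U :+ K :+ R)
                                 := (U :+ K :+ o :- R) :* (U :+ K :+ R) :+ :- (U :+ K :+ R) :* (M :+ K :+ o :- R))
                        refl u m (ι k) r 1#

  N-term-expansion : ∀ r u m d k → k ≤ d →
    (u - m) * (u + ι d + r) * (g r k (u - 1#) d * p r k m)
      ≈ ∑ (λ i → g r k u d * γ r i k u d * p r (k +ℕ i) m) 0 3
  N-term-expansion r u m d k k≤d = begin
    (u - m) * (u + ι d + r) * (g r k (u - 1#) d * P)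
      ≈⟨ solve 5 (λ U M D G P → (U :- M) :* D :* (G :* P) := (U :- M) :* (D :* G) :* P)
               refl u m (u + ι d + r) (g r k (u - 1#) d) P ⟩
    (u - m) * ((u + ι d + r) * g r k (u - 1#) d) * P
      ≈⟨ *-congʳ (*-congˡ (g-pred-u r u d k k≤d)) ⟩
    (u - m) * ((u + ι k + r) * Gk) * P
      ≈⟨ solve 4 (λ L W G P → L :* (W :* G) :* P := G :* (L :* W) :* P)
               refl (u - m) (u + ι k + r) Gk P ⟩
    Gk * ((u - m) * (u + ι k + r)) * P
      ≈⟨ *-congʳ (*-congˡ (γ-split r u m k d)) ⟩
    Gk * (γ r 0 k u d + γ r 1 k u d * s) * P
      -- γ r 2 k u d reduces to 0#, matched by con (+ 0).
      ≈⟨ solve 6 (λ G C₀ C₁ S P Q → G :* (C₀ :+ C₁ :* S) :* P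
                    := G :* C₀ :* P :+ (G :* C₁ :* (P :* S) :+ (G :* con (+ 0) :* Q :+ con (+ 0))))
               refl Gk (γ r 0 k u d) (γ r 1 k u d) s P (p r (k +ℕ 2) m) ⟩
    Gk * γ r 0 k u d * P + (Gk * γ r 1 k u d * (P * s) + (Gk * γ r 2 k u d * p r (k +ℕ 2) m + 0#))
      ≈⟨ +-cong (*-congˡ (reflexive (≡.cong (λ j → p r j m) (≡.sym (ℕ.+-identityʳ k)))))
                (+-congʳ (*-congˡ (sym (p-+1 r k m)))) ⟩
    ∑ (λ i → Gk * γ r i k u d * p r (k +ℕ i) m) 0 3 ∎
    where
    Gk P s : Carrier
    Gk = g r k u d
    P  = p r k m
    s  = m + ι k + 1# - r

proposition5p5 : {c ℓ : Level} (R : CommutativeRing c ℓ) →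
    let open CommutativeRing R
        open WithRing R
    in (r u m : Carrier) (d : ℕ) →
       (u - m) * (u + ι d + r) * N r (u - 1#) d m
         ≈ ∑ (λ k → ∑ (λ i → g r k u d * γ r i k u d * p r (k +ℕ i) m) 0 3) 0 (suc d)
proposition5p5 R r u m d =
  trans (*-distribˡ-∑ R _ _ 0 (suc d))
        (∑-cong-< R _ _ 0 (suc d) (λ k k<1+d → N-term-expansion R r u m d k (ℕ.≤-pred k<1+d)))
  where open CommutativeRing R using (trans)
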